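{- Let $\mathcal{P}_\nu$ be the set of partitions $\lambda=(\lambda_1>\lambda_2>\cdots>\lambda_\ell)$ into distinct parts in $\mathbb{Z}_{\ge0}$ (a smallest part $0$ is allowed) such that every odd part $\lambda_i$ satisfies $\lambda_i<2\lambda_\ell$. For $\lambda=(\lambda_1,\dots,\lambda_\ell)\in\mathcal{P}_\nu$ with $\ell\ge2$ define $\rho^-(\lambda)$ by: (i) if $\lambda_\ell=0$: $\rho^-(\lambda)=(\lambda_1-2,\dots,\lambda_{\ell-1}-2)$; (ii) if $\lambda_\ell\ge1$ and $\lambda_{\ell-1}=\lambda_\ell+1$: let $\mu=(\mu_1,\dots,\mu_{\ell-1})$ be the nonincreasing rearrangement of $(\lambda_1,\dots,\lambda_{\ell-2},\lambda_{\ell-1}+\lambda_\ell)$ and $\rho^-(\lambda)=(\mu_1-2,\dots,\mu_{\ell-1}-2)$; (iii) if $\lambda_\ell\ge1$ and $\lambda_{\ell-1}\ge\lambda_\ell+2$: $\rho^-(\lambda)$ is the nonincreasing rearrangement of $(\lambda_1-2,\dots,\lambda_{\ell-1}-2,\lambda_\ell-1)$. Then $\rho^-(\lambda)\in\mathcal{P}_\nu$. -}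

module Defs where

open import Data.Nat using (ℕ; zero; suc; _+_; _*_; _∸_; _<_; _>_; _≤?_; _≟_)
open import Data.Nat.DivMod using (_%_)
open import Data.List using (List; []; _∷_; _++_; map; foldr)
open import Data.List.Relation.Unary.All using (All)
open import Data.List.Relation.Unary.Linked using (Linked)
open import Data.Product using (_×_)
open import Data.Unit using (⊤)
open import Relation.Binary.PropositionalEquality using (_≡_)
open import Relation.Nullary using (yes; no)

Odd : ℕ → Set
Odd n = n % 2 ≡ 1

lastOf : ℕ → List ℕ → ℕ
lastOf x []       = x
lastOf _ (y ∷ ys) = lastOf y ys

-- Partitions are lists written λ₁ ∷ λ₂ ∷ … ∷ λℓ ∷ [] (largest part first).
Pν : List ℕ → Set
Pν []       = ⊤
Pν (x ∷ xs) = Linked _>_ (x ∷ xs)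
            × All (λ p → Odd p → p < 2 * lastOf x xs) (x ∷ xs)

insertDesc : ℕ → List ℕ → List ℕ
insertDesc x []       = x ∷ []
insertDesc x (y ∷ ys) with y ≤? x
... | yes _ = x ∷ y ∷ ys
... | no  _ = y ∷ insertDesc x ys

sortDesc : List ℕ → List ℕ
sortDesc = foldr insertDesc []

-- ρ⁻ of λ = xs ++ (a ∷ b ∷ [])  (so a = λ_{ℓ-1}, b = λ_ℓ, ℓ ≥ 2).
-- Case b ≥ 1 and a ≠ b + 1 is case (iii) (a ≥ b + 2) for λ ∈ Pν.
ρ⁻ : List ℕ → ℕ → ℕ → List ℕ
ρ⁻ xs a zero = map (_∸ 2) (xs ++ a ∷ [])
ρ⁻ xs a (suc b) with a ≟ suc (suc b)
... | yes _ = map (_∸ 2) (sortDesc (xs ++ (a + suc b) ∷ []))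
... | no  _ = sortDesc (map (_∸ 2) (xs ++ a ∷ []) ++ (suc b ∸ 1) ∷ [])

module Submission where

-- A strictly decreasing list whose parts are all ≥ m and whose
-- odd parts are all < 2m lies in Pν: its last part is ≥ m, so the defining
-- bound 2·λℓ is only weaker.  Call such parts "admissible for m".  Each case
-- of ρ⁻ produces a list of parts admissible for a suitable m:
--   (i)   λℓ = 0:   m = 0;  every remaining part is even and positive, hence ≥ 2;
--   (ii)  λℓ₋₁ = λℓ + 1 = m + 1:  the merged part 2m + 1 is odd, so it differs
--         from every other part (odd parts are < 2m);
--   (iii) λℓ₋₁ ≥ λℓ + 2, m = λℓ - 1:  the new last part m is admissible for itself.
-- In every case the parts λᵢ − 2 come from parts λᵢ ≥ m + 2 with odd λᵢ < 2(m+1),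
-- and such a λᵢ − 2 is admissible for m.

open import Defs
open import Data.Nat using (ℕ)
open import Data.List using (List; []; _∷_; _++_)

open import Data.Nat using (zero; suc; _+_; _*_; _∸_; _<_; _>_; _≤_; _≤?_; _≟_; z≤n; s≤s; z<s)
open import Data.Nat.Properties
  using (≤-refl; <-trans; <-≤-trans; <⇒≤; ≤-pred; n≤1+n; n<1+n; m≤n+m; m<m+n; m+n≤o⇒m≤o;
         +-identityʳ; +-suc; *-monoʳ-≤; *-suc; ∸-monoˡ-<; ≤∧≢⇒<; ≰⇒>; >⇒≢; <-irrefl; n≮0)
open import Data.List using (map)
open import Data.List.Relation.Unary.All as All using (All; []; _∷_)
import Data.List.Relation.Unary.All.Properties as AllP
open import Data.List.Relation.Unary.AllPairs as AllPairs using (AllPairs; []; _∷_)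
import Data.List.Relation.Unary.AllPairs.Properties as AllPairsP
open import Data.List.Relation.Unary.Linked using (Linked)
import Data.List.Relation.Unary.Linked.Properties as LinkedP
open import Data.List.Properties using (++-assoc)
open import Data.Product using (_×_; _,_; proj₁; proj₂)
open import Data.Unit using (tt)
open import Data.Empty using (⊥-elim)
open import Relation.Nullary using (yes; no)
open import Relation.Binary.PropositionalEquality using (_≡_; _≢_; refl; sym; trans; cong; subst)
open import Function using (_∘_)

Decreasing : List ℕ → Set
Decreasing = AllPairs _>_

OddBounded : ℕ → ℕ → Set
OddBounded m p = Odd p → p < 2 * m

Admissible : ℕ → ℕ → Set
Admissible m p = m ≤ p × OddBounded m p

-- A part y that becomes admissible for m after subtracting 2.
Shiftable : ℕ → ℕ → Set
Shiftable m y = 2 + m ≤ y × OddBounded (suc m) y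

AllPairs-∷ʳ⁺ : ∀ {A : Set} {R : A → A → Set} {xs z} →
               AllPairs R xs → All (λ x → R x z) xs → AllPairs R (xs ++ z ∷ [])
AllPairs-∷ʳ⁺ rs xz = AllPairsP.++⁺ rs ([] ∷ []) (All.map (_∷ []) xz)

AllPairs-∷ʳ⁻ : ∀ {A : Set} {R : A → A → Set} xs {z} →
               AllPairs R (xs ++ z ∷ []) → AllPairs R xs × All (λ x → R x z) xs
AllPairs-∷ʳ⁻ []       _         = [] , []
AllPairs-∷ʳ⁻ (x ∷ xs) (rx ∷ rs) with AllPairs-∷ʳ⁻ xs rs | AllP.∷ʳ⁻ rx
... | rxs , xsz | rx′ , rxz = rx′ ∷ rxs , rxz ∷ xsz

≥-last : ∀ xs {a} → Decreasing (xs ++ a ∷ []) → All (a ≤_) (xs ++ a ∷ [])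
≥-last xs dec = AllP.∷ʳ⁺ (All.map <⇒≤ (proj₂ (AllPairs-∷ʳ⁻ xs dec))) ≤-refl

decreasing-∸ : ∀ k {L} → All (k ≤_) L → Decreasing L → Decreasing (map (_∸ k) L)
decreasing-∸ k []          []          = []
decreasing-∸ k (_ ∷ k≤L)  (x>L ∷ dec) =
  AllP.map⁺ (All.zipWith (λ (k≤y , y<x) → ∸-monoˡ-< y<x k≤y) (k≤L , x>L)) ∷ decreasing-∸ k k≤L dec

lastOf-∷ʳ : ∀ x ys {z} → lastOf x (ys ++ z ∷ []) ≡ z
lastOf-∷ʳ x []       = refl
lastOf-∷ʳ x (y ∷ ys) = lastOf-∷ʳ y ys

All-lastOf : ∀ {P : ℕ → Set} x xs → All P (x ∷ xs) → P (lastOf x xs)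
All-lastOf x []       (px ∷ _) = px
All-lastOf x (y ∷ ys) (_ ∷ ps) = All-lastOf y ys ps

insertDesc-All : ∀ {P : ℕ → Set} {x} L → P x → All P L → All P (insertDesc x L)
insertDesc-All             []       px []         = px ∷ []
insertDesc-All {x = x} (y ∷ ys) px (py ∷ pys) with y ≤? x
... | yes _ = px ∷ py ∷ pys
... | no  _ = py ∷ insertDesc-All ys px pys

sortDesc-All : ∀ {P : ℕ → Set} L → All P L → All P (sortDesc L)
sortDesc-All []      []        = []
sortDesc-All (x ∷ L) (px ∷ pL) = insertDesc-All (sortDesc L) px (sortDesc-All L pL)

insertDesc-decreasing : ∀ {x} L → All (x ≢_) L → Decreasing L → Decreasing (insertDesc x L)
insertDesc-decreasing       []       _             _           = [] ∷ []
insertDesc-decreasing {x} (y ∷ ys) (x≢y ∷ x≢ys) (y>ys ∷ dec) with y ≤? x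
... | yes y≤x = (y<x ∷ All.map (λ z<y → <-trans z<y y<x) y>ys) ∷ y>ys ∷ dec
  where y<x = ≤∧≢⇒< y≤x (x≢y ∘ sym)
... | no  y≰x = insertDesc-All ys (≰⇒> y≰x) y>ys ∷ insertDesc-decreasing ys x≢ys dec

sortDesc-decreasing : ∀ L → AllPairs _≢_ L → Decreasing (sortDesc L)
sortDesc-decreasing []      []            = []
sortDesc-decreasing (x ∷ L) (x≢L ∷ dist) =
  insertDesc-decreasing (sortDesc L) (sortDesc-All L x≢L) (sortDesc-decreasing L dist)

oddBounded-mono : ∀ {m n p} → m ≤ n → OddBounded m p → OddBounded n p
oddBounded-mono m≤n bound odd = <-≤-trans (bound odd) (*-monoʳ-≤ 2 m≤n)

oddBounded-≢ : ∀ {m x s} → Odd s → 2 * m ≤ s → OddBounded m x → x ≢ s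
oddBounded-≢ odd 2m≤s bound refl = <-irrefl refl (<-≤-trans (bound odd) 2m≤s)

-- Every b is admissible for itself: an odd b is positive, so b < 2b.
self-admissible : ∀ b → Admissible b b
self-admissible zero    = z≤n , λ ()
self-admissible (suc c) = ≤-refl , λ _ → m<m+n (suc c) z<s

≤-∸2 : ∀ {n y} → 2 + n ≤ y → n ≤ y ∸ 2
≤-∸2 (s≤s (s≤s n≤y)) = n≤y

-- If y ≥ m + 2 and odd y < 2(m + 1), then y − 2 is admissible for m
-- (y − 2 has the parity of y).
shiftable⇒admissible : ∀ {m y} → Shiftable m y → Admissible m (y ∸ 2)
shiftable⇒admissible {m} {suc (suc y)} (s≤s (s≤s m≤y) , bound) =
  m≤y , λ odd → ≤-pred (≤-pred (subst (suc (suc y) <_) (*-suc 2 m) (bound odd)))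

positive-shiftable : ∀ {y} → 0 < y → OddBounded 0 y → Shiftable 0 y
positive-shiftable {suc zero}    _ bound = ⊥-elim (n≮0 (bound refl))
positive-shiftable {suc (suc y)} _ bound = s≤s (s≤s z≤n) , oddBounded-mono {n = 1} z≤n bound

double : ∀ m → 2 * m ≡ m + m
double m = cong (m +_) (+-identityʳ m)

odd-2m+1 : ∀ m → Odd (suc (m + m))
odd-2m+1 zero    = refl
odd-2m+1 (suc m) = subst (Odd ∘ suc ∘ suc) (sym (+-suc m m)) (odd-2m+1 m)

merged-shiftable : ∀ {m} → 0 < m → Shiftable m (suc (m + m))
merged-shiftable {suc k} _ =
  s≤s (s≤s (m≤n+m (suc k) k)) ,
  λ _ → subst (suc (m + m) <_) (sym (trans (*-suc 2 m) (cong (2 +_) (double m)))) (n<1+n _)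
  where
  m : ℕ
  m = suc k

Pν-intro : ∀ {m} L → Decreasing L → All (Admissible m) L → Pν L
Pν-intro []       _   _   = tt
Pν-intro {m} (x ∷ xs) dec adm =
  LinkedP.AllPairs⇒Linked dec ,
  All.map (λ a → oddBounded-mono m≤last (proj₂ a)) adm
  where
  m≤last : m ≤ lastOf x xs
  m≤last = All-lastOf x xs (All.map proj₁ adm)

Pν-sort : ∀ {m} L → AllPairs _≢_ L → All (Admissible m) L → Pν (sortDesc L)
Pν-sort L dist adm = Pν-intro (sortDesc L) (sortDesc-decreasing L dist) (sortDesc-All L adm)

decreasing-∸2 : ∀ {m L} → Decreasing L → All (Shiftable m) L → Decreasing (map (_∸ 2) L)
decreasing-∸2 dec shift = decreasing-∸ 2 (All.map (λ s → m+n≤o⇒m≤o 2 (proj₁ s)) shift) dec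

Pν-∸2 : ∀ {m} L → Decreasing L → All (Shiftable m) L → Pν (map (_∸ 2) L)
Pν-∸2 L dec shift =
  Pν-intro (map (_∸ 2) L) (decreasing-∸2 dec shift) (AllP.map⁺ (All.map shiftable⇒admissible shift))

Linked⇒Decreasing : ∀ {L} → Linked _>_ L → Decreasing L
Linked⇒Decreasing = LinkedP.Linked⇒AllPairs (λ x>y y>z → <-trans y>z x>y)

Pν-∷ʳ-parts : ∀ L {b} → Pν (L ++ b ∷ []) →
              Decreasing (L ++ b ∷ []) × All (OddBounded b) (L ++ b ∷ [])
Pν-∷ʳ-parts []           (linked , odd) = Linked⇒Decreasing linked , odd
Pν-∷ʳ-parts (x ∷ xs) {b} (linked , odd) =
  Linked⇒Decreasing linked ,
  subst (λ l → All (λ p → Odd p → p < 2 * l) (x ∷ xs ++ b ∷ [])) (lastOf-∷ʳ x xs) odd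

record AboveLast (L : List ℕ) (b : ℕ) : Set where
  constructor aboveLast
  field
    decreasing : Decreasing L
    above      : All (_> b) L
    oddBounded : All (OddBounded b) L

Pν-∷ʳ⁻ : ∀ L {b} → Pν (L ++ b ∷ []) → AboveLast L b
Pν-∷ʳ⁻ L hyp with Pν-∷ʳ-parts L hyp
... | dec , odd with AllPairs-∷ʳ⁻ L dec
...   | decL , above = aboveLast decL above (AllP.++⁻ˡ L odd)

Pν-init : ∀ xs a b → Pν (xs ++ a ∷ b ∷ []) → AboveLast (xs ++ a ∷ []) b
Pν-init xs a b hyp = Pν-∷ʳ⁻ (xs ++ a ∷ []) (subst Pν (sym (++-assoc xs (a ∷ []) (b ∷ []))) hyp)

-- (i) λℓ = 0: every other part is positive and even, so shiftable for 0.
ρ⁻-zero : ∀ xs a → AboveLast (xs ++ a ∷ []) 0 → Pν (map (_∸ 2) (xs ++ a ∷ []))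
ρ⁻-zero xs a (aboveLast dec above odd) =
  Pν-∸2 (xs ++ a ∷ []) dec
    (All.zipWith (λ (pos , bound) → positive-shiftable pos bound) (above , odd))

-- (ii) λℓ₋₁ = m + 1, λℓ = m > 0: the merged part 2m + 1 is odd and ≥ 2m, hence
-- distinct from the other parts, and all parts are shiftable for m.
ρ⁻-adjacent : ∀ xs {m} → 0 < m → AboveLast (xs ++ suc m ∷ []) m →
              Pν (map (_∸ 2) (sortDesc (xs ++ suc (m + m) ∷ [])))
ρ⁻-adjacent xs {m} m>0 (aboveLast dec _ odd) =
  Pν-∸2 (sortDesc M) (sortDesc-decreasing M distinct) (sortDesc-All M shiftable)
  where
  M : List ℕ
  M = xs ++ suc (m + m) ∷ []

  xs-dec : Decreasing xs × All (_> suc m) xs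
  xs-dec = AllPairs-∷ʳ⁻ xs dec

  xs-odd : All (OddBounded m) xs
  xs-odd = AllP.++⁻ˡ xs odd

  2m≤merged : 2 * m ≤ suc (m + m)
  2m≤merged = subst (_≤ suc (m + m)) (sym (double m)) (n≤1+n _)

  distinct : AllPairs _≢_ M
  distinct = AllPairs-∷ʳ⁺ (AllPairs.map >⇒≢ (proj₁ xs-dec))
                          (All.map (oddBounded-≢ {m = m} (odd-2m+1 m) 2m≤merged) xs-odd)

  shiftable : All (Shiftable m) M
  shiftable = AllP.∷ʳ⁺
    (All.zipWith (λ (x>a , bound) → x>a , oddBounded-mono (n≤1+n m) bound) (proj₂ xs-dec , xs-odd))
    (merged-shiftable m>0)

-- (iii) λℓ₋₁ ≥ λℓ + 2, λℓ = b + 1: every part λᵢ ≥ b + 3 is shiftable for b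
-- and λᵢ − 2 > b, while the new last part b is admissible for itself.
ρ⁻-lower : ∀ xs a b → a ≢ 2 + b → AboveLast (xs ++ a ∷ []) (suc b) →
           Pν (sortDesc (map (_∸ 2) (xs ++ a ∷ []) ++ b ∷ []))
ρ⁻-lower xs a b a≢b+2 (aboveLast dec above odd) =
  Pν-sort N (AllPairs.map >⇒≢ N-dec)
    (AllP.∷ʳ⁺ (AllP.map⁺ (All.map shiftable⇒admissible shiftable)) (self-admissible b))
  where
  L : List ℕ
  L = xs ++ a ∷ []

  N : List ℕ
  N = map (_∸ 2) L ++ b ∷ []

  a>b+2 : a > 2 + b
  a>b+2 = ≤∧≢⇒< (proj₂ (AllP.∷ʳ⁻ above)) (a≢b+2 ∘ sym)

  large : All (2 + b <_) L
  large = All.map (<-≤-trans a>b+2) (≥-last xs dec)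

  shiftable : All (Shiftable b) L
  shiftable = All.zipWith (λ (y>b+2 , bound) → <⇒≤ y>b+2 , bound) (large , odd)

  N-dec : Decreasing N
  N-dec = AllPairs-∷ʳ⁺ (decreasing-∸2 dec shiftable) (AllP.map⁺ (All.map ≤-∸2 large))

lemma3 : (xs : List ℕ) (a b : ℕ) → Pν (xs ++ a ∷ b ∷ []) → Pν (ρ⁻ xs a b)
lemma3 xs a zero hyp = ρ⁻-zero xs a (Pν-init xs a zero hyp)
lemma3 xs a (suc b) hyp with a ≟ suc (suc b)
... | yes refl  = ρ⁻-adjacent xs z<s (Pν-init xs a (suc b) hyp)
... | no a≢b+2 = ρ⁻-lower xs a b a≢b+2 (Pν-init xs a (suc b) hyp)
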